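{- Let $\mathcal{M}_1=(V,\mathcal{I}_1),\dots,\mathcal{M}_k=(V,\mathcal{I}_k)$ be matroids on a common ground set $V$ with $|V|=n$, accessible through rank oracles. There is an algorithm which, given a partition $(S_1,\dots,S_k)$ of a set $S\subseteq V$ with $S_i\in\mathcal{I}_i$ for all $i$, outputs for every vertex $v\in V\cup\{s\}\cup T$ the distance from $v$ to $T$ in the compressed exchange graph $G(S_1,\dots,S_k)$, using $O((n+k)\log n)$ rank oracle queries.
   Context: The compressed exchange graph $G(S_1,\dots,S_k)$ is the directed graph on vertex set $V\cup\{s,t_1,\dots,t_k\}$, $T=\{t_1,\dots,t_k\}$, with edge set $E'\cup E_s\cup E_t$ where $E'=\{(v,u): \exists i\in[k],\ u\in S_i,\ S_i+v\notin\mathcal{I}_i,\ S_i+v-u\in\mathcal{I}_i\}$, $E_s=\{(s,v): v\in V\setminus S\}$, $E_t=\bigcup_{i=1}^k\{(v,t_i): v\in V\setminus S_i,\ S_i+v\in\mathcal{I}_i\}$. The distance from $v$ to $T$ is the length of a shortest directed path from $v$ to some vertex of $T$ ($\infty$ if none). A rank oracle for $\mathcal{M}_i$ returns $\mathrm{rank}_{\mathcal{M}_i}(X)=\max\{|Y|:Y\subseteq X, Y\in\mathcal{I}_i\}$ for given $X\subseteq V$. -}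

module Defs where

open import Data.Nat using (ℕ; zero; suc; _+_; _*_; _≤_; _<_)
open import Data.Nat.Logarithm using (⌊log₂_⌋)
open import Data.Fin using (Fin; _≟_)
open import Data.Fin.Subset using (Subset; _∈_; _∉_; _⊆_; _∪_; _-_; ⁅_⁆; ∣_∣; ⊥; _─_)
open import Data.Vec using (tabulate)
open import Data.Bool using (Bool; true; false)
open import Data.Maybe using (Maybe; just; nothing; is-just)
open import Data.Product using (Σ; ∃; _×_; _,_; proj₁; proj₂)
open import Relation.Nullary using (¬_; Dec; does)
open import Relation.Binary.PropositionalEquality using (_≡_)

record Matroid (n : ℕ) : Set₁ where
  field
    Indep      : Subset n → Set
    indep?     : (X : Subset n) → Dec (Indep X)
    indep-∅    : Indep ⊥
    indep-⊆    : ∀ {X Y} → X ⊆ Y → Indep Y → Indep X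
    indep-exch : ∀ {X Y} → Indep X → Indep Y → ∣ X ∣ < ∣ Y ∣ →
                 ∃ λ x → x ∈ Y × x ∉ X × Indep (X ∪ ⁅ x ⁆)
open Matroid public

IsRank : ∀ {n} → Matroid n → Subset n → ℕ → Set
IsRank M X r =
  (∃ λ Y → Y ⊆ X × Indep M Y × ∣ Y ∣ ≡ r) ×
  (∀ Y → Y ⊆ X → Indep M Y → ∣ Y ∣ ≤ r)

-- A partition (S_1,...,S_k) of a set S ⊆ V is encoded by an assignment
-- part : Fin n → Maybe (Fin k):  v ∈ S_i  iff  part v ≡ just i.

Part : ℕ → ℕ → Set
Part n k = Fin n → Maybe (Fin k)

inPart : ∀ {k} → Maybe (Fin k) → Fin k → Bool
inPart nothing  i = false
inPart (just j) i = does (j ≟ i)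

S[_] : ∀ {n k} → Part n k → Fin k → Subset n
S[ part ] i = tabulate (λ v → inPart (part v) i)

Sall : ∀ {n k} → Part n k → Subset n
Sall part = tabulate (λ v → is-just (part v))

data Vtx (n k : ℕ) : Set where
  elem : Fin n → Vtx n k
  src  : Vtx n k
  tgt  : Fin k → Vtx n k

data Edge {n k} (M : Fin k → Matroid n) (part : Part n k) : Vtx n k → Vtx n k → Set where
  exch : ∀ i v u → u ∈ S[ part ] i →
         ¬ Indep (M i) (S[ part ] i ∪ ⁅ v ⁆) →
         Indep (M i) ((S[ part ] i ∪ ⁅ v ⁆) - u) →
         Edge M part (elem v) (elem u)
  fromS : ∀ v → v ∉ Sall part → Edge M part src (elem v)
  toT   : ∀ i v → v ∉ S[ part ] i → Indep (M i) (S[ part ] i ∪ ⁅ v ⁆) →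
          Edge M part (elem v) (tgt i)

data ReachT {n k} (M : Fin k → Matroid n) (part : Part n k) : Vtx n k → ℕ → Set where
  here : ∀ i → ReachT M part (tgt i) 0
  step : ∀ {v w ℓ} → Edge M part v w → ReachT M part w ℓ → ReachT M part v (suc ℓ)

-- d is the distance from v to T (nothing = ∞)
IsDistToT : ∀ {n k} → (Fin k → Matroid n) → Part n k → Vtx n k → Maybe ℕ → Set
IsDistToT M part v (just d) = ReachT M part v d × (∀ ℓ → ReachT M part v ℓ → d ≤ ℓ)
IsDistToT M part v nothing  = ∀ ℓ → ¬ ReachT M part v ℓ

-- Rank-oracle algorithms: decision trees whose internal nodes ask
-- rank_{M_i}(X) and branch on the answer.

data OracleAlg (n k : ℕ) (A : Set) : Set where
  ret : A → OracleAlg n k A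
  ask : Fin k → Subset n → (ℕ → OracleAlg n k A) → OracleAlg n k A

run : ∀ {n k A} → (Fin k → Subset n → ℕ) → OracleAlg n k A → A × ℕ
run rk (ret a) = a , 0
run rk (ask i X f) with run rk (f (rk i X))
... | a , q = a , suc q

-- O((n+k) log n) bound with constant c (log n read as 1 + ⌊log₂ n⌋)
bound : ℕ → ℕ → ℕ → ℕ
bound c n k = c * (n + k) * suc ⌊log₂ n ⌋

module Submission where

-- The distances to T are computed by breadth-first search backwards from T, one layer at a time.
-- Layer 1 consists of the v ∉ Sᵢ with Sᵢ + v ∈ ℐᵢ for some i.  An unlabelled v has an edge into a
-- vertex u ∈ Sᵢ of the current layer iff v ∉ Sᵢ − u and Sᵢ − u + v ∈ ℐᵢ; the remaining condition
-- Sᵢ + v ∉ ℐᵢ is automatic, since otherwise v would already lie in layer 1.  So each step of the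
-- search is a task (i, B) with B ∈ ℐᵢ: label every unlabelled v ∉ B with B + v ∈ ℐᵢ.  For independent
-- B, rank(B ∪ X) > |B| iff X contains such a v, so one rank query decides whether the unlabelled
-- elements contain one, and binary search finds it with ⌊log₂ n⌋ + 1 further queries.  There are
-- k tasks for the targets and at most one per element of S, each costing one unsuccessful query,
-- and each of the n elements is labelled at most once, which gives O((n + k) log n) queries.

open import Defs
open import Data.Bool.Base using (Bool; true; false; if_then_else_; T)
open import Data.Empty using (⊥; ⊥-elim)
open import Data.Fin.Base using (Fin; zero; suc)
open import Data.Fin.Properties using () renaming (_≟_ to _≟ᶠ_)
open import Data.Fin.Subset using (Subset; _∈_; _∉_; _⊆_; _∪_; _-_; _─_; ⁅_⁆; ∣_∣; ⋃)
open import Data.Fin.Subset.Properties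
  using (x∈⁅x⁆; x∈⁅y⁆⇒x≡y; ∉⊥; p⊆p∪q; x∈p∪q⁺; x∈p∪q⁻; p─q⊆p; x∈p∧x≢y⇒x∈p-y; p⊂q⇒∣p∣<∣q∣; _∈?_)
open import Data.List.Base using (List; []; _∷_; length; map; take; drop; allFin; foldr)
open import Data.List.Properties using (length-map; length-take; length-drop; length-tabulate)
open import Data.List.Membership.Propositional using (find; lose) renaming (_∈_ to _∈ˡ_)
open import Data.List.Membership.Propositional.Properties using (∈-map⁺; ∈-map⁻; ∈-allFin)
open import Data.List.Relation.Unary.Any using (Any; here; there; toSum; fromSum)
open import Data.Maybe.Base using (Maybe; just; nothing; is-nothing) renaming (map to mapᴹ)
open import Data.Maybe.Properties using (just-injective)
open import Data.Nat.Base
open import Data.Nat.Properties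
open import Data.Nat.Logarithm using (⌊log₂_⌋; ⌊log₂⌋-mono-≤; ⌊log₂[2^n]⌋≡n)
open import Data.Nat.Tactic.RingSolver using (solve-∀)
open import Algebra.Properties.CommutativeSemigroup +-commutativeSemigroup using (x∙yz≈y∙xz)
open import Data.Product using (Σ; ∃; _×_; _,_; proj₁; proj₂)
open import Data.Sum using (_⊎_; inj₁; inj₂)
open import Data.Unit using (⊤; tt)
open import Data.Vec.Base using (Vec; []; _∷_; lookup; _[_]≔_; replicate; countᵇ; _[_]=_)
open _[_]=_ using () renaming (here to here⁼; there to there⁼)
open import Data.Vec.Properties
  using (lookup∘update; lookup∘update′; lookup-replicate; count≤n; lookup∘tabulate; []=⇒lookup; lookup⇒[]=)
open import Function using (_∘_; id)
open import Relation.Nullary using (¬_; Dec; yes; no)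
open import Relation.Nullary.Decidable using (T?; dec-true)
open import Relation.Binary.PropositionalEquality

_>>=_ : ∀ {n k A B} → OracleAlg n k A → (A → OracleAlg n k B) → OracleAlg n k B
ret a     >>= f = f a
ask i X g >>= f = ask i X (λ r → g r >>= f)

_<$>_ : ∀ {n k A B} → (A → B) → OracleAlg n k A → OracleAlg n k B
f <$> ret a     = ret (f a)
f <$> ask i X g = ask i X (λ r → f <$> g r)

module Oracle {n k : ℕ} (rk : Fin k → Subset n → ℕ) where

  infix 4 _satisfies_

  _satisfies_ : ∀ {A} → OracleAlg n k A → (A → ℕ → Set) → Set
  m satisfies P = P (proj₁ (run rk m)) (proj₂ (run rk m))

  >>=-satisfies : ∀ {A B} (m : OracleAlg n k A) {f : A → OracleAlg n k B}
                  {P : A → ℕ → Set} {Q : B → ℕ → Set} →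
                  m satisfies P → (∀ a q → P a q → f a satisfies (λ b q′ → Q b (q + q′))) →
                  (m >>= f) satisfies Q
  >>=-satisfies (ret a)     p hf = hf a 0 p
  >>=-satisfies (ask i X g) {f} {P} {Q} p hf =
    >>=-satisfies (g (rk i X)) {f} {λ a q → P a (suc q)} {λ b q → Q b (suc q)} p (λ a q → hf a (suc q))

  <$>-satisfies : ∀ {A B} (m : OracleAlg n k A) {f : A → B} {P : A → ℕ → Set} {Q : B → ℕ → Set} →
                  (∀ {a q} → P a q → Q (f a) q) → m satisfies P → (f <$> m) satisfies Q
  <$>-satisfies (ret a)     P⇒Q p = P⇒Q p
  <$>-satisfies (ask i X g) {f} {P} {Q} P⇒Q p =
    <$>-satisfies (g (rk i X)) {f} {λ a q → P a (suc q)} {λ b q → Q b (suc q)} P⇒Q p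

-- Unlike `if does d then … else …`, this stays stuck on `d`, so `with d` can see the decision in proofs.
ifᵈ_then_else_ : ∀ {P A : Set} → Dec P → A → A → A
ifᵈ yes _ then a else b = a
ifᵈ no _  then a else b = b

n<2^suc⌊log₂n⌋ : ∀ n → n < 2 ^ suc ⌊log₂ n ⌋
n<2^suc⌊log₂n⌋ n = ≰⇒> λ 2^≤n →
  1+n≰n (subst (_≤ ⌊log₂ n ⌋) (⌊log₂[2^n]⌋≡n (suc ⌊log₂ n ⌋)) (⌊log₂⌋-mono-≤ 2^≤n))

potential-nonincreasing : ∀ {q₀ q c t u u′ p′} → q + c * u′ ≤ t + c * u → p′ + u′ ≡ u →
                          q₀ + q + suc c * u′ + p′ ≤ q₀ + suc c * u + t
potential-nonincreasing {q₀} {q} {c} {t} {u} {u′} {p′} paid p′+u′≡u = begin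
  q₀ + q + suc c * u′ + p′        ≡⟨ regroup q₀ q c u′ p′ ⟩
  q₀ + (q + c * u′) + (p′ + u′)   ≤⟨ +-mono-≤ (+-monoʳ-≤ q₀ paid) (≤-reflexive p′+u′≡u) ⟩
  q₀ + (t + c * u) + u            ≡⟨ collect q₀ t c u ⟩
  q₀ + suc c * u + t              ∎
  where
  open ≤-Reasoning
  regroup : ∀ q₀ q c u′ p′ → q₀ + q + suc c * u′ + p′ ≡ q₀ + (q + c * u′) + (p′ + u′)
  regroup = solve-∀
  collect : ∀ q₀ t c u → q₀ + (t + c * u) + u ≡ q₀ + suc c * u + t
  collect = solve-∀

findIndicesᵇ : ∀ {A : Set} {m} → (A → Bool) → Vec A m → List (Fin m)
findIndicesᵇ p []       = []
findIndicesᵇ p (a ∷ as) = if p a then zero ∷ rest else rest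
  where rest = map suc (findIndicesᵇ p as)

module _ {A : Set} (p : A → Bool) where

  ∈-findIndicesᵇ⁺ : ∀ {m} (as : Vec A m) {x} → p (lookup as x) ≡ true → x ∈ˡ findIndicesᵇ p as
  ∈-findIndicesᵇ⁺ (a ∷ as) {zero}  px rewrite px = here refl
  ∈-findIndicesᵇ⁺ (a ∷ as) {suc x} px with p a
  ... | true  = there (∈-map⁺ suc (∈-findIndicesᵇ⁺ as px))
  ... | false = ∈-map⁺ suc (∈-findIndicesᵇ⁺ as px)

  ∈-findIndicesᵇ⁻ : ∀ {m} (as : Vec A m) {x} → x ∈ˡ findIndicesᵇ p as → p (lookup as x) ≡ true
  ∈-findIndicesᵇ⁻ (a ∷ as) x∈ with p a in pa
  ∈-findIndicesᵇ⁻ (a ∷ as) (here refl) | true = pa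
  ∈-findIndicesᵇ⁻ (a ∷ as) (there x∈) | true with ∈-map⁻ suc x∈
  ... | _ , y∈ , refl = ∈-findIndicesᵇ⁻ as y∈
  ∈-findIndicesᵇ⁻ (a ∷ as) x∈ | false with ∈-map⁻ suc x∈
  ... | _ , y∈ , refl = ∈-findIndicesᵇ⁻ as y∈

  length-findIndicesᵇ : ∀ {m} (as : Vec A m) → length (findIndicesᵇ p as) ≡ countᵇ p as
  length-findIndicesᵇ []       = refl
  length-findIndicesᵇ (a ∷ as) with p a
  ... | true  = cong suc (trans (length-map suc (findIndicesᵇ p as)) (length-findIndicesᵇ as))
  ... | false = trans (length-map suc (findIndicesᵇ p as)) (length-findIndicesᵇ as)

  countᵇ-[]≔-true : ∀ {m} (as : Vec A m) x {a} → p (lookup as x) ≡ false → p a ≡ true →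
                    countᵇ p (as [ x ]≔ a) ≡ suc (countᵇ p as)
  countᵇ-[]≔-true (b ∷ as) zero    pb pa rewrite pa | pb = refl
  countᵇ-[]≔-true (b ∷ as) (suc x) pb pa with p b
  ... | true  = cong suc (countᵇ-[]≔-true as x pb pa)
  ... | false = countᵇ-[]≔-true as x pb pa

  countᵇ-[]≔-false : ∀ {m} (as : Vec A m) x {a} → p (lookup as x) ≡ true → p a ≡ false →
                     countᵇ p as ≡ suc (countᵇ p (as [ x ]≔ a))
  countᵇ-[]≔-false (b ∷ as) zero    pb pa rewrite pa | pb = refl
  countᵇ-[]≔-false (b ∷ as) (suc x) pb pa with p b
  ... | true  = cong suc (countᵇ-[]≔-false as x pb pa)
  ... | false = countᵇ-[]≔-false as x pb pa

  countᵇ-none : ∀ {m} (as : Vec A m) → (∀ x → p (lookup as x) ≡ false) → countᵇ p as ≡ 0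
  countᵇ-none []       _    = refl
  countᵇ-none (a ∷ as) none rewrite none zero = countᵇ-none as (none ∘ suc)

  countᵇ-all : ∀ {m} (as : Vec A m) → (∀ x → p (lookup as x) ≡ true) → countᵇ p as ≡ m
  countᵇ-all []       _   = refl
  countᵇ-all (a ∷ as) all rewrite all zero = cong suc (countᵇ-all as (all ∘ suc))

  countᵇ-pos : ∀ {m} (as : Vec A m) x → p (lookup as x) ≡ true → 0 < countᵇ p as
  countᵇ-pos (a ∷ as) zero    pa rewrite pa = s≤s z≤n
  countᵇ-pos (a ∷ as) (suc x) px with p a
  ... | true  = s≤s z≤n
  ... | false = countᵇ-pos as x px

module _ {A : Set} where

  ∈-take⇒∈ : ∀ m {xs} {x : A} → x ∈ˡ take m xs → x ∈ˡ xs
  ∈-take⇒∈ (suc m) {_ ∷ _} (here refl) = here refl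
  ∈-take⇒∈ (suc m) {_ ∷ _} (there x∈) = there (∈-take⇒∈ m x∈)

  ∈-drop⇒∈ : ∀ m {xs} {x : A} → x ∈ˡ drop m xs → x ∈ˡ xs
  ∈-drop⇒∈ zero             x∈ = x∈
  ∈-drop⇒∈ (suc m) {_ ∷ _} x∈ = there (∈-drop⇒∈ m x∈)

  any-take⊎drop : ∀ {P : A → Set} m {xs} → Any P xs → Any P (take m xs) ⊎ Any P (drop m xs)
  any-take⊎drop zero    any         = inj₂ any
  any-take⊎drop (suc m) (here p)    = inj₁ (here p)
  any-take⊎drop (suc m) (there any) with any-take⊎drop m any
  ... | inj₁ any-take = inj₁ (there any-take)
  ... | inj₂ any-drop = inj₂ any-drop

  length-take≤ : ∀ m (xs : List A) → length (take m xs) ≤ m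
  length-take≤ m xs = ≤-trans (≤-reflexive (length-take m xs)) (m⊓n≤m m (length xs))

  length-drop≤ : ∀ m (xs : List A) → length xs ≤ 2 * m → length (drop m xs) ≤ m
  length-drop≤ m xs ∣xs∣≤ = ≤-trans (≤-reflexive (length-drop m xs))
    (m≤n+o⇒m∸n≤o (length xs) m (≤-trans ∣xs∣≤ (≤-reflexive (cong (m +_) (+-identityʳ m)))))

fromList : ∀ {n} → List (Fin n) → Subset n
fromList xs = ⋃ (map ⁅_⁆ xs)

∈-fromList⁺ : ∀ {n} {x : Fin n} {xs} → x ∈ˡ xs → x ∈ fromList xs
∈-fromList⁺ {xs = y ∷ ys} (here refl) = x∈p∪q⁺ (inj₁ (x∈⁅x⁆ y))
∈-fromList⁺ {xs = y ∷ ys} (there x∈)  = x∈p∪q⁺ (inj₂ (∈-fromList⁺ x∈))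

∈-fromList⁻ : ∀ {n} {x : Fin n} xs → x ∈ fromList xs → x ∈ˡ xs
∈-fromList⁻ []       x∈ = ⊥-elim (∉⊥ x∈)
∈-fromList⁻ (y ∷ ys) x∈ with x∈p∪q⁻ ⁅ y ⁆ (fromList ys) x∈
... | inj₁ x∈y  = here (x∈⁅y⁆⇒x≡y y x∈y)
... | inj₂ x∈ys = there (∈-fromList⁻ ys x∈ys)

x∈p─q⇒x∉q : ∀ {n} {x : Fin n} (p q : Subset n) → x ∈ p ─ q → x ∉ q
x∈p─q⇒x∉q (true ∷ p) (false ∷ q) here⁼            ()
x∈p─q⇒x∉q (_ ∷ p)    (_ ∷ q)     (there⁼ x∈p─q) (there⁼ x∈q) = x∈p─q⇒x∉q p q x∈p─q x∈q

x∈p-y⇒x≢y : ∀ {n} {x y : Fin n} (p : Subset n) → x ∈ p - y → x ≢ y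
x∈p-y⇒x≢y {y = y} p x∈ refl = x∈p─q⇒x∉q p ⁅ y ⁆ x∈ (x∈⁅x⁆ y)

p∪⁅x⁆-y⊆p-y∪⁅x⁆ : ∀ {n} (p : Subset n) x y → (p ∪ ⁅ x ⁆) - y ⊆ (p - y) ∪ ⁅ x ⁆
p∪⁅x⁆-y⊆p-y∪⁅x⁆ p x y z∈ with x∈p∪q⁻ p ⁅ x ⁆ (p─q⊆p (p ∪ ⁅ x ⁆) ⁅ y ⁆ z∈)
... | inj₁ z∈p = x∈p∪q⁺ (inj₁ (x∈p∧x≢y⇒x∈p-y z∈p (x∈p-y⇒x≢y (p ∪ ⁅ x ⁆) z∈)))
... | inj₂ z∈x = x∈p∪q⁺ (inj₂ z∈x)

p-y∪⁅x⁆⊆p∪⁅x⁆-y : ∀ {n} (p : Subset n) {x y} → x ≢ y → (p - y) ∪ ⁅ x ⁆ ⊆ (p ∪ ⁅ x ⁆) - y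
p-y∪⁅x⁆⊆p∪⁅x⁆-y p {x} {y} x≢y z∈ with x∈p∪q⁻ (p - y) ⁅ x ⁆ z∈
... | inj₁ z∈p-y = x∈p∧x≢y⇒x∈p-y (x∈p∪q⁺ (inj₁ (p─q⊆p p ⁅ y ⁆ z∈p-y))) (x∈p-y⇒x≢y p z∈p-y)
... | inj₂ z∈x rewrite x∈⁅y⁆⇒x≡y x z∈x = x∈p∧x≢y⇒x∈p-y (x∈p∪q⁺ (inj₂ (x∈⁅x⁆ x))) x≢y

p∪⁅x⁆⊆p : ∀ {n} (p : Subset n) {x} → x ∈ p → p ∪ ⁅ x ⁆ ⊆ p
p∪⁅x⁆⊆p p {x} x∈p z∈ with x∈p∪q⁻ p ⁅ x ⁆ z∈
... | inj₁ z∈p = z∈p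
... | inj₂ z∈x rewrite x∈⁅y⁆⇒x≡y x z∈x = x∈p

x∉p⇒∣p∣<∣p∪⁅x⁆∣ : ∀ {n} (p : Subset n) {x} → x ∉ p → ∣ p ∣ < ∣ p ∪ ⁅ x ⁆ ∣
x∉p⇒∣p∣<∣p∪⁅x⁆∣ p {x} x∉p = p⊂q⇒∣p∣<∣q∣ (p⊆p∪q ⁅ x ⁆ , x , x∈p∪q⁺ (inj₂ (x∈⁅x⁆ x)) , x∉p)

minᴹ : Maybe ℕ → Maybe ℕ → Maybe ℕ
minᴹ nothing  y        = y
minᴹ (just a) nothing  = just a
minᴹ (just a) (just b) = just (a ⊓ b)

minJust : List (Maybe ℕ) → Maybe ℕ
minJust = foldr minᴹ nothing

minJust-∈ : ∀ xs {a} → minJust xs ≡ just a → just a ∈ˡ xs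
minJust-∈ (nothing ∷ xs) eq = there (minJust-∈ xs eq)
minJust-∈ (just a ∷ xs)  eq with minJust xs in eq′
... | nothing = here (sym eq)
... | just b with ⊓-sel a b
...   | inj₁ a⊓b≡a = here (trans (sym eq) (cong just a⊓b≡a))
...   | inj₂ a⊓b≡b = there (minJust-∈ xs (trans eq′ (trans (cong just (sym a⊓b≡b)) eq)))

∈⇒minJust≤ : ∀ {xs a} → just a ∈ˡ xs → ∃ λ b → minJust xs ≡ just b × b ≤ a
∈⇒minJust≤ {just a ∷ xs} (here refl) with minJust xs
... | nothing = a , refl , ≤-refl
... | just b  = a ⊓ b , refl , m⊓n≤m a b
∈⇒minJust≤ {x ∷ xs} (there a∈) with ∈⇒minJust≤ a∈
... | b , eq , b≤a rewrite eq with x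
...   | nothing = b , refl , b≤a
...   | just c  = c ⊓ b , refl , ≤-trans (m⊓n≤n c b) b≤a

module _ {n} (M : Matroid n) where

  Augments : Subset n → Fin n → Set
  Augments B v = v ∉ B × Indep M (B ∪ ⁅ v ⁆)

  augments⇒rank> : ∀ {B X r v} → IsRank M (B ∪ X) r → v ∈ X → Augments B v → ∣ B ∣ < r
  augments⇒rank> {B} {X} {v = v} (_ , maximal) v∈X (v∉B , indep) =
    ≤-trans (x∉p⇒∣p∣<∣p∪⁅x⁆∣ B v∉B) (maximal (B ∪ ⁅ v ⁆) B∪v⊆B∪X indep)
    where
    B∪v⊆B∪X : B ∪ ⁅ v ⁆ ⊆ B ∪ X
    B∪v⊆B∪X z∈ with x∈p∪q⁻ B ⁅ v ⁆ z∈
    ... | inj₁ z∈B = x∈p∪q⁺ (inj₁ z∈B)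
    ... | inj₂ z∈v rewrite x∈⁅y⁆⇒x≡y v z∈v = x∈p∪q⁺ (inj₂ v∈X)

  rank>⇒augments : ∀ {B X r} → Indep M B → IsRank M (B ∪ X) r → ∣ B ∣ < r →
                   ∃ λ v → v ∈ X × Augments B v
  rank>⇒augments {B} {X} indep-B ((Y , Y⊆B∪X , indep-Y , ∣Y∣≡r) , _) ∣B∣<r
    with indep-exch M indep-B indep-Y (≤-trans ∣B∣<r (≤-reflexive (sym ∣Y∣≡r)))
  ... | v , v∈Y , v∉B , indep with x∈p∪q⁻ B X (Y⊆B∪X v∈Y)
  ...   | inj₁ v∈B = ⊥-elim (v∉B v∈B)
  ...   | inj₂ v∈X = v , v∈X , v∉B , indep

module _ {n k : ℕ} {part : Part n k} where

  ∈S⇒part≡ : ∀ {v i} → v ∈ S[ part ] i → part v ≡ just i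
  ∈S⇒part≡ {v} {i} v∈ = inPart-true (part v) (trans (sym (lookup∘tabulate _ v)) ([]=⇒lookup v∈))
    where
    inPart-true : ∀ x → inPart x i ≡ true → x ≡ just i
    inPart-true (just j) eq with j ≟ᶠ i
    inPart-true (just j) eq | yes refl = refl
    inPart-true (just j) () | no _
    inPart-true nothing  ()

  part≡⇒∈S : ∀ {v i} → part v ≡ just i → v ∈ S[ part ] i
  part≡⇒∈S {v} {i} eq =
    lookup⇒[]= v _ (trans (lookup∘tabulate _ v) (trans (cong (λ x → inPart x i) eq) (dec-true (i ≟ᶠ i) refl)))

  module _ {M : Fin k → Matroid n} where

    ReachT-tgt : ∀ {i ℓ} → ReachT M part (tgt i) ℓ → ℓ ≡ 0
    ReachT-tgt (here i)   = refl
    ReachT-tgt (step () _)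

    exch⇒augments : (∀ i → Indep (M i) (S[ part ] i)) → ∀ {v u} → Edge M part (elem v) (elem u) →
                    ∃ λ i → part u ≡ just i × Augments (M i) (S[ part ] i - u) v
    exch⇒augments S-indep (exch i v u u∈S dependent indep) =
      i , ∈S⇒part≡ u∈S , (v∉S ∘ p─q⊆p (S[ part ] i) ⁅ u ⁆) ,
      indep-⊆ (M i) (p-y∪⁅x⁆⊆p∪⁅x⁆-y (S[ part ] i) (λ { refl → v∉S u∈S })) indep
      where
      v∉S : v ∉ S[ part ] i
      v∉S v∈S = dependent (indep-⊆ (M i) (p∪⁅x⁆⊆p (S[ part ] i) v∈S) (S-indep i))

    augments⇒exch : ∀ {v u i} → part u ≡ just i → u ≢ v → Augments (M i) (S[ part ] i - u) v →
                    ¬ Augments (M i) (S[ part ] i) v → Edge M part (elem v) (elem u)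
    augments⇒exch {v} {u} {i} part-u u≢v (v∉S-u , indep) no-edge-to-T =
      exch i v u (part≡⇒∈S part-u) dependent (indep-⊆ (M i) (p∪⁅x⁆-y⊆p-y∪⁅x⁆ (S[ part ] i) v u) indep)
      where
      dependent : ¬ Indep (M i) (S[ part ] i ∪ ⁅ v ⁆)
      dependent indep-S+v with v ∈? S[ part ] i
      ... | yes v∈S = v∉S-u (x∈p∧x≢y⇒x∈p-y v∈S (u≢v ∘ sym))
      ... | no  v∉S = no-edge-to-T (v∉S , indep-S+v)

Labels : ℕ → Set
Labels n = Vec (Maybe ℕ) n

Task : ℕ → ℕ → Set
Task n k = Fin k × Subset n

labelIs : ℕ → Maybe ℕ → Bool
labelIs d (just a) = a ≡ᵇ d
labelIs d nothing  = false

labelIs-refl : ∀ d → labelIs d (just d) ≡ true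
labelIs-refl zero    = refl
labelIs-refl (suc d) = labelIs-refl d

labelIs⇒≡ : ∀ {d} x → labelIs d x ≡ true → x ≡ just d
labelIs⇒≡ {d} (just a) eq = cong just (≡ᵇ⇒≡ a d (subst T (sym eq) tt))

is-nothing⇒≡ : ∀ {A : Set} (x : Maybe A) → is-nothing x ≡ true → x ≡ nothing
is-nothing⇒≡ nothing _ = refl

nothing≢just : ∀ {A : Set} {a : A} → nothing ≢ just a
nothing≢just ()

labelled≢unlabelled : ∀ {n} (D : Labels n) {u v a} → lookup D u ≡ just a → lookup D v ≡ nothing → u ≢ v
labelled≢unlabelled D Du Dv refl with () ← trans (sym Du) Dv

unlabelled-reflected : ∀ {n} (D D′ : Labels n) → (∀ {v a} → lookup D v ≡ just a → lookup D′ v ≡ just a) →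
                       ∀ {v} → lookup D′ v ≡ nothing → lookup D v ≡ nothing
unlabelled-reflected D D′ preserves {v} D′v with lookup D v in Dv
... | nothing = refl
... | just a with () ← trans (sym (preserves Dv)) D′v

unlabelled : ∀ {n} → Labels n → ℕ
unlabelled = countᵇ is-nothing

labelled : ∀ {n} → ℕ → Labels n → ℕ
labelled d = countᵇ (labelIs d)

unlabelled-replicate : ∀ n → unlabelled (replicate n nothing) ≡ n
unlabelled-replicate n = countᵇ-all is-nothing (replicate n nothing) (λ v → cong is-nothing (lookup-replicate v nothing))

labelled-replicate : ∀ n d → labelled d (replicate n nothing) ≡ 0
labelled-replicate n d = countᵇ-none (labelIs d) (replicate n nothing) (λ v → cong (labelIs d) (lookup-replicate v nothing))

unlabelled≤n : ∀ {n} (D : Labels n) → unlabelled D ≤ n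
unlabelled≤n = count≤n (T? ∘ is-nothing)

searchDepth : ℕ → ℕ
searchDepth n = suc ⌊log₂ n ⌋

costPerLabel : ℕ → ℕ
costPerLabel n = suc (searchDepth n)

budget : ℕ → ℕ → ℕ
budget n k = k + suc (costPerLabel n) * n

module _ {n : ℕ} where

  -- D′ arises from D by giving the label m to exactly the unlabelled elements satisfying G; the q
  -- queries are paid for by one query per task and costPerLabel per newly labelled element.
  record Step (m : ℕ) (G : Fin n → Set) (tasks : ℕ) (D D′ : Labels n) (q : ℕ) : Set where
    field
      preserves  : ∀ {v a} → lookup D v ≡ just a → lookup D′ v ≡ just a
      new-labels : ∀ {v a} → lookup D′ v ≡ just a → lookup D v ≡ just a ⊎ (lookup D v ≡ nothing × a ≡ m × G v)
      saturated  : ∀ {v} → lookup D′ v ≡ nothing → ¬ G v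
      cost       : q + costPerLabel n * unlabelled D′ ≤ tasks + costPerLabel n * unlabelled D
      conserved  : labelled m D′ + unlabelled D′ ≡ labelled m D + unlabelled D
  open Step public

  step-stop : ∀ {m G tasks D q} → q ≤ tasks → (∀ {v} → lookup D v ≡ nothing → ¬ G v) → Step m G tasks D D q
  step-stop q≤tasks saturated = record
    { preserves = λ Dv → Dv ; new-labels = inj₁ ; saturated = saturated
    ; cost = +-monoˡ-≤ _ q≤tasks ; conserved = refl }

  step-cong : ∀ {m G G′ tasks D D′ q} → (∀ {v} → G v → G′ v) → (∀ {v} → G′ v → G v) →
              Step m G tasks D D′ q → Step m G′ tasks D D′ q
  step-cong G⇒G′ G′⇒G st = record
    { preserves  = preserves st
    ; new-labels = λ D′v → Data.Sum.map₂ (λ (Dv , a≡m , g) → Dv , a≡m , G⇒G′ g) (new-labels st D′v)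
    ; saturated  = λ D′v g′ → saturated st D′v (G′⇒G g′)
    ; cost       = cost st
    ; conserved  = conserved st
    }

  step-∷ : ∀ {m G G′ a b D D₁ D₂ q₁ q₂} → Step m G a D D₁ q₁ → Step m G′ b D₁ D₂ q₂ →
           Step m (λ v → G v ⊎ G′ v) (a + b) D D₂ (q₁ + q₂)
  step-∷ {m} {G} {G′} {a} {b} {D} {D₁} {D₂} {q₁} {q₂} st₁ st₂ = record
    { preserves  = preserves st₂ ∘ preserves st₁
    ; new-labels = new
    ; saturated  = λ D₂v → Data.Sum.[ saturated st₁ (unlabelled-reflected D₁ D₂ (preserves st₂) D₂v)
                                    , saturated st₂ D₂v ]
    ; cost       = total-cost
    ; conserved  = trans (conserved st₂) (conserved st₁)
    }
    where
    new : ∀ {v x} → lookup D₂ v ≡ just x → lookup D v ≡ just x ⊎ (lookup D v ≡ nothing × x ≡ m × (G v ⊎ G′ v))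
    new D₂v with new-labels st₂ D₂v
    ... | inj₂ (D₁v , x≡m , g′) = inj₂ (unlabelled-reflected D D₁ (preserves st₁) D₁v , x≡m , inj₂ g′)
    ... | inj₁ D₁v with new-labels st₁ D₁v
    ...   | inj₁ Dv             = inj₁ Dv
    ...   | inj₂ (Dv , x≡m , g) = inj₂ (Dv , x≡m , inj₁ g)
    c = costPerLabel n
    total-cost : q₁ + q₂ + c * unlabelled D₂ ≤ a + b + c * unlabelled D
    total-cost = begin
      q₁ + q₂ + c * unlabelled D₂     ≡⟨ +-assoc q₁ q₂ _ ⟩
      q₁ + (q₂ + c * unlabelled D₂)   ≤⟨ +-monoʳ-≤ q₁ (cost st₂) ⟩
      q₁ + (b + c * unlabelled D₁)   ≡⟨ x∙yz≈y∙xz q₁ b _ ⟩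
      b + (q₁ + c * unlabelled D₁)   ≤⟨ +-monoʳ-≤ b (cost st₁) ⟩
      b + (a + c * unlabelled D)     ≡⟨ x∙yz≈y∙xz b a _ ⟩
      a + (b + c * unlabelled D)     ≡⟨ +-assoc a b _ ⟨
      a + b + c * unlabelled D       ∎
      where open ≤-Reasoning

  step-label : ∀ {m G tasks D D′ q v} → lookup D v ≡ nothing → G v →
               Step m G tasks (D [ v ]≔ just m) D′ q → Step m G tasks D D′ (costPerLabel n + q)
  step-label {m} {G} {tasks} {D} {D′} {q} {v} Dv g st = record
    { preserves  = λ {w} Dw → preserves st (trans (lookup∘update′ (labelled≢unlabelled D Dw Dv) D (just m)) Dw)
    ; new-labels = new
    ; saturated  = saturated st
    ; cost       = total-cost
    ; conserved  = total-conserved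
    }
    where
    D₁ = D [ v ]≔ just m
    c = costPerLabel n
    new : ∀ {w a} → lookup D′ w ≡ just a → lookup D w ≡ just a ⊎ (lookup D w ≡ nothing × a ≡ m × G w)
    new {w} D′w with new-labels st D′w | w ≟ᶠ v
    ... | inj₁ D₁v | yes refl = inj₂ (Dv , just-injective (trans (sym D₁v) (lookup∘update v D (just m))) , g)
    ... | inj₂ (D₁v , _) | yes refl with () ← trans (sym D₁v) (lookup∘update v D (just m))
    ... | inj₁ D₁w | no w≢v = inj₁ (trans (sym (lookup∘update′ w≢v D (just m))) D₁w)
    ... | inj₂ (D₁w , a≡m , g′) | no w≢v = inj₂ (trans (sym (lookup∘update′ w≢v D (just m))) D₁w , a≡m , g′)
    unlabelled-drops : unlabelled D ≡ suc (unlabelled D₁)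
    unlabelled-drops = countᵇ-[]≔-false is-nothing D v (cong is-nothing Dv) refl
    labelled-grows : labelled m D₁ ≡ suc (labelled m D)
    labelled-grows = countᵇ-[]≔-true (labelIs m) D v (cong (labelIs m) Dv) (labelIs-refl m)
    total-cost : c + q + c * unlabelled D′ ≤ tasks + c * unlabelled D
    total-cost = begin
      c + q + c * unlabelled D′      ≡⟨ +-assoc c q _ ⟩
      c + (q + c * unlabelled D′)    ≤⟨ +-monoʳ-≤ c (cost st) ⟩
      c + (tasks + c * unlabelled D₁) ≡⟨ x∙yz≈y∙xz c tasks _ ⟩
      tasks + (c + c * unlabelled D₁) ≡⟨ cong (tasks +_) (*-suc c (unlabelled D₁)) ⟨
      tasks + c * suc (unlabelled D₁) ≡⟨ cong (λ u → tasks + c * u) unlabelled-drops ⟨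
      tasks + c * unlabelled D       ∎
      where open ≤-Reasoning
    total-conserved : labelled m D′ + unlabelled D′ ≡ labelled m D + unlabelled D
    total-conserved = begin
      labelled m D′ + unlabelled D′        ≡⟨ conserved st ⟩
      labelled m D₁ + unlabelled D₁        ≡⟨ cong (_+ unlabelled D₁) labelled-grows ⟩
      suc (labelled m D) + unlabelled D₁   ≡⟨ +-suc (labelled m D) (unlabelled D₁) ⟨
      labelled m D + suc (unlabelled D₁)   ≡⟨ cong (labelled m D +_) unlabelled-drops ⟨
      labelled m D + unlabelled D          ∎
      where open ≡-Reasoning

  step-labels : ∀ {m G tasks D D′ q v} → Step m G tasks D D′ q → lookup D v ≡ nothing → G v →
                lookup D′ v ≡ just m
  step-labels {D′ = D′} {v = v} st Dv g with lookup D′ v in D′v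
  ... | nothing = ⊥-elim (saturated st D′v g)
  ... | just a with new-labels st D′v
  ...   | inj₁ Dv′              with () ← trans (sym Dv) Dv′
  ...   | inj₂ (_ , refl , _) = refl

module Search {n k : ℕ} where

  -- x₀ is only a dummy answer for an empty list of candidates.
  search : ℕ → Fin k → Subset n → Fin n → List (Fin n) → OracleAlg n k (Fin n)
  search zero    i B x₀ []      = ret x₀
  search zero    i B x₀ (x ∷ _) = ret x
  search (suc h) i B x₀ xs =
    ask i (B ∪ fromList (take (2 ^ h) xs)) λ r →
      ifᵈ ∣ B ∣ <? r then search h i B x₀ (take (2 ^ h) xs) else search h i B x₀ (drop (2 ^ h) xs)

  findAugmenting : ℕ → Fin k → Subset n → List (Fin n) → OracleAlg n k (Maybe (Fin n))
  findAugmenting h i B []       = ret nothing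
  findAugmenting h i B (x ∷ xs) =
    ask i (B ∪ fromList (x ∷ xs)) λ r →
      ifᵈ ∣ B ∣ <? r then just <$> search h i B x (x ∷ xs) else ret nothing

module Labelling {n k : ℕ} where
  open Search {n} {k}

  saturate       : ℕ → Task n k → ℕ → Labels n → OracleAlg n k (Labels n)
  labelAndRepeat : ℕ → Task n k → ℕ → Labels n → Maybe (Fin n) → OracleAlg n k (Labels n)

  saturate zero    t       m D = ret D
  saturate (suc f) (i , B) m D =
    findAugmenting (searchDepth n) i B (findIndicesᵇ is-nothing D) >>= labelAndRepeat f (i , B) m D

  labelAndRepeat f t m D nothing  = ret D
  labelAndRepeat f t m D (just v) = saturate f t m (D [ v ]≔ just m)

  saturateᴹ : Maybe (Task n k) → ℕ → Labels n → OracleAlg n k (Labels n)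
  saturateᴹ nothing  m D = ret D
  saturateᴹ (just t) m D = saturate (suc n) t m D

  saturateAll : {A : Set} → (A → Maybe (Task n k)) → List A → ℕ → Labels n → OracleAlg n k (Labels n)
  saturateAll task []       m D = ret D
  saturateAll task (x ∷ xs) m D = saturateᴹ (task x) m D >>= saturateAll task xs m

module Algorithm {n k : ℕ} (part : Part n k) where
  open Labelling {n} {k}

  targetTask : Fin k → Maybe (Task n k)
  targetTask i = just (i , S[ part ] i)

  exchangeTask : Fin n → Maybe (Task n k)
  exchangeTask u = mapᴹ (λ i → i , S[ part ] i - u) (part u)

  -- A round with an empty frontier costs no query, so always running n rounds is harmless.
  rounds : ℕ → ℕ → Labels n → OracleAlg n k (Labels n)
  rounds zero    d D = ret D
  rounds (suc f) d D = saturateAll exchangeTask (findIndicesᵇ (labelIs d) D) (suc d) D >>= rounds f (suc d)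

  sourceLabel : Labels n → Fin n → Maybe ℕ
  sourceLabel D v = ifᵈ v ∈? Sall part then nothing else lookup D v

  distances : Labels n → Vtx n k → Maybe ℕ
  distances D (elem v) = lookup D v
  distances D src      = mapᴹ suc (minJust (map (sourceLabel D) (allFin n)))
  distances D (tgt i)  = just 0

  bfs : OracleAlg n k (Vtx n k → Maybe ℕ)
  bfs = saturateAll targetTask (allFin k) 1 (replicate n nothing) >>= λ D →
        rounds n 1 D >>= λ D′ → ret (distances D′)

module Correctness {n k : ℕ} (M : Fin k → Matroid n) (rk : Fin k → Subset n → ℕ)
                   (rk-isRank : ∀ i X → IsRank (M i) X (rk i X)) where
  open Oracle rk
  open Search {n} {k}
  open Labelling {n} {k}

  rank>⇒any : ∀ {i B} xs → Indep (M i) B → ∣ B ∣ < rk i (B ∪ fromList xs) → Any (Augments (M i) B) xs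
  rank>⇒any {i} xs indep-B ∣B∣<r with rank>⇒augments (M i) indep-B (rk-isRank i _) ∣B∣<r
  ... | v , v∈xs , augments = lose (∈-fromList⁻ xs v∈xs) augments

  any⇒rank> : ∀ {i B xs} → Any (Augments (M i) B) xs → ∣ B ∣ < rk i (B ∪ fromList xs)
  any⇒rank> {i} any with find any
  ... | v , v∈xs , augments = augments⇒rank> (M i) (rk-isRank i _) (∈-fromList⁺ v∈xs) augments

  Hit : Fin k → Subset n → ℕ → List (Fin n) → Fin n → ℕ → Set
  Hit i B h xs v q = v ∈ˡ xs × Augments (M i) B v × q ≡ h

  search-finds : ∀ h {i B} x₀ xs → Indep (M i) B → length xs ≤ 2 ^ h → Any (Augments (M i) B) xs →
                 search h i B x₀ xs satisfies Hit i B h xs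
  search-finds zero x₀ []          _ _       ()
  search-finds zero x₀ (x ∷ [])    _ _       (here augments) = here refl , augments , refl
  search-finds zero x₀ (x ∷ [])    _ _       (there ())
  search-finds zero x₀ (x ∷ _ ∷ _) _ (s≤s ()) _
  search-finds (suc h) {i} {B} x₀ xs indep-B ∣xs∣≤ any
    with ∣ B ∣ <? rk i (B ∪ fromList (take (2 ^ h) xs))
  ... | yes ∣B∣<r
    with search-finds h x₀ (take (2 ^ h) xs) indep-B (length-take≤ (2 ^ h) xs) (rank>⇒any _ indep-B ∣B∣<r)
  ...   | v∈ , augments , q≡h = ∈-take⇒∈ (2 ^ h) v∈ , augments , cong suc q≡h
  search-finds (suc h) {i} {B} x₀ xs indep-B ∣xs∣≤ any | no ∣B∣≮r with any-take⊎drop (2 ^ h) any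
  ... | inj₁ any-take = ⊥-elim (∣B∣≮r (any⇒rank> any-take))
  ... | inj₂ any-drop
    with search-finds h x₀ (drop (2 ^ h) xs) indep-B (length-drop≤ (2 ^ h) xs ∣xs∣≤) any-drop
  ...   | v∈ , augments , q≡h = ∈-drop⇒∈ (2 ^ h) v∈ , augments , cong suc q≡h

  Found : Fin k → Subset n → ℕ → List (Fin n) → Maybe (Fin n) → ℕ → Set
  Found i B h xs nothing  q = ¬ Any (Augments (M i) B) xs × q ≤ 1
  Found i B h xs (just v) q = Hit i B (suc h) xs v q

  findAugmenting-finds : ∀ h {i B} xs → Indep (M i) B → length xs ≤ 2 ^ h →
                         findAugmenting h i B xs satisfies Found i B h xs
  findAugmenting-finds h []       _ _ = (λ ()) , z≤n
  findAugmenting-finds h {i} {B} (x ∷ xs) indep-B ∣xs∣≤ with ∣ B ∣ <? rk i (B ∪ fromList (x ∷ xs))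
  ... | yes ∣B∣<r = <$>-satisfies (search h i B x (x ∷ xs)) {just} {Hit i B h (x ∷ xs)}
                      {λ v q → Found i B h (x ∷ xs) v (suc q)}
                      (λ (v∈ , augments , q≡h) → v∈ , augments , cong suc q≡h)
                      (search-finds h x (x ∷ xs) indep-B ∣xs∣≤ (rank>⇒any (x ∷ xs) indep-B ∣B∣<r))
  ... | no ∣B∣≮r  = (λ any → ∣B∣≮r (any⇒rank> any)) , s≤s z≤n

  Augmentsᵗ : Maybe (Task n k) → Fin n → Set
  Augmentsᵗ nothing        v = ⊥
  Augmentsᵗ (just (i , B)) v = Augments (M i) B v

  Valid : Maybe (Task n k) → Set
  Valid nothing        = ⊤
  Valid (just (i , B)) = Indep (M i) B

  saturate-saturates : ∀ f i B m D → Indep (M i) B → unlabelled D < f →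
                       saturate f (i , B) m D satisfies Step m (Augments (M i) B) 1 D
  saturate-saturates (suc f) i B m D indep-B ∣D∣<f =
    >>=-satisfies (findAugmenting (searchDepth n) i B U) {Q = Step m (Augments (M i) B) 1 D}
      (findAugmenting-finds (searchDepth n) U indep-B ∣U∣≤) continue
    where
    U = findIndicesᵇ is-nothing D
    ∣U∣≤ : length U ≤ 2 ^ searchDepth n
    ∣U∣≤ = ≤-trans (≤-reflexive (length-findIndicesᵇ is-nothing D))
             (≤-trans (unlabelled≤n D) (<⇒≤ (n<2^suc⌊log₂n⌋ n)))
    continue : ∀ r q → Found i B (searchDepth n) U r q →
               labelAndRepeat f (i , B) m D r satisfies λ D′ q′ → Step m (Augments (M i) B) 1 D D′ (q + q′)
    continue nothing q (none , q≤1) =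
      step-stop (≤-trans (≤-reflexive (+-identityʳ q)) q≤1)
        (λ Dv augments → none (lose (∈-findIndicesᵇ⁺ is-nothing D (cong is-nothing Dv)) augments))
    continue (just v) .(suc (searchDepth n)) (v∈U , augments , refl) =
      step-label Dv augments (saturate-saturates f i B m (D [ v ]≔ just m) indep-B ∣D₁∣<f)
      where
      Dv : lookup D v ≡ nothing
      Dv = is-nothing⇒≡ (lookup D v) (∈-findIndicesᵇ⁻ is-nothing D v∈U)
      ∣D₁∣<f : unlabelled (D [ v ]≔ just m) < f
      ∣D₁∣<f = ≤-trans (≤-reflexive (sym (countᵇ-[]≔-false is-nothing D v (cong is-nothing Dv) refl)))
                       (≤-pred ∣D∣<f)

  saturateᴹ-saturates : ∀ t m D → Valid t → saturateᴹ t m D satisfies Step m (Augmentsᵗ t) 1 D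
  saturateᴹ-saturates nothing        m D _       = step-stop z≤n (λ _ ())
  saturateᴹ-saturates (just (i , B)) m D indep-B =
    saturate-saturates (suc n) i B m D indep-B (s≤s (unlabelled≤n D))

  AugmentsSome : {A : Set} → (A → Maybe (Task n k)) → List A → Fin n → Set
  AugmentsSome task xs v = Any (λ x → Augmentsᵗ (task x) v) xs

  saturateAll-saturates : ∀ {A : Set} (task : A → Maybe (Task n k)) → (∀ x → Valid (task x)) → ∀ xs m D →
                          saturateAll task xs m D satisfies Step m (AugmentsSome task xs) (length xs) D
  saturateAll-saturates task valid []       m D = step-stop z≤n (λ _ ())
  saturateAll-saturates task valid (x ∷ xs) m D =
    >>=-satisfies (saturateᴹ (task x) m D) {Q = Step m (AugmentsSome task (x ∷ xs)) (length (x ∷ xs)) D}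
      (saturateᴹ-saturates (task x) m D (valid x))
      λ D₁ q₁ st₁ → step-cong fromSum toSum (step-∷ st₁ (saturateAll-saturates task valid xs m D₁))

  module _ (part : Part n k) (S-indep : ∀ i → Indep (M i) (S[ part ] i)) where
    open Algorithm part

    Reach : Vtx n k → ℕ → Set
    Reach = ReachT M part

    record BFSUpTo (d : ℕ) (D : Labels n) : Set where
      field
        sound    : ∀ {v a} → lookup D v ≡ just a → Reach (elem v) a
        complete : ∀ {v ℓ} → Reach (elem v) ℓ → ℓ ≤ d → ∃ λ a → lookup D v ≡ just a × a ≤ ℓ
        bounded  : ∀ {v a} → lookup D v ≡ just a → a ≤ d
        -- the layers 1, …, d are nonempty
        layered  : ∀ {v} → lookup D v ≡ just d → d + unlabelled D ≤ n
    open BFSUpTo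

    nothing-beyond : ∀ {d D} → BFSUpTo d D → labelled (suc d) D ≡ 0
    nothing-beyond {d} {D} inv = countᵇ-none (labelIs (suc d)) D not-suc-d
      where
      not-suc-d : ∀ v → labelIs (suc d) (lookup D v) ≡ false
      not-suc-d v with labelIs (suc d) (lookup D v) in is-suc-d
      ... | false = refl
      ... | true  = ⊥-elim (1+n≰n (bounded inv (labelIs⇒≡ (lookup D v) is-suc-d)))

    exchangeTask-valid : ∀ u → Valid (exchangeTask u)
    exchangeTask-valid u with part u
    ... | nothing = tt
    ... | just i  = indep-⊆ (M i) (p─q⊆p (S[ part ] i) ⁅ u ⁆) (S-indep i)

    edge⇒augmentsᵗ : ∀ {v u} → Edge M part (elem v) (elem u) → Augmentsᵗ (exchangeTask u) v
    edge⇒augmentsᵗ e with exch⇒augments S-indep e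
    ... | i , part-u , augments rewrite part-u = augments

    augmentsᵗ⇒edge : ∀ {v u} → u ≢ v → (∀ i → ¬ Augments (M i) (S[ part ] i) v) →
                     Augmentsᵗ (exchangeTask u) v → Edge M part (elem v) (elem u)
    augmentsᵗ⇒edge {v} {u} u≢v no-edge-to-T augments with part u in part-u
    ... | just i = augments⇒exch part-u u≢v augments (no-edge-to-T i)

    first-layer : ∀ {tasks D q} → Step 1 (AugmentsSome targetTask (allFin k)) tasks (replicate n nothing) D q →
                  BFSUpTo 1 D
    first-layer {D = D} st = record { sound = sound′ ; complete = complete′ ; bounded = bounded′ ; layered = layered′ }
      where
      D₀ = replicate n nothing
      new : ∀ {v a} → lookup D v ≡ just a → a ≡ 1 × AugmentsSome targetTask (allFin k) v
      new {v} Dv with new-labels st Dv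
      ... | inj₁ D₀v            with () ← trans (sym (lookup-replicate v nothing)) D₀v
      ... | inj₂ (_ , a≡1 , g) = a≡1 , g
      sound′ : ∀ {v a} → lookup D v ≡ just a → Reach (elem v) a
      sound′ Dv with new Dv
      ... | refl , g with find g
      ...   | i , _ , v∉S , indep = step (toT i _ v∉S indep) (here i)
      bounded′ : ∀ {v a} → lookup D v ≡ just a → a ≤ 1
      bounded′ Dv = ≤-reflexive (proj₁ (new Dv))
      complete′ : ∀ {v ℓ} → Reach (elem v) ℓ → ℓ ≤ 1 → ∃ λ a → lookup D v ≡ just a × a ≤ ℓ
      complete′ (step (exch _ _ _ _ _ _) (step _ _)) (s≤s ())
      complete′ {v} (step (toT i _ v∉S indep) _) (s≤s _) with lookup D v in Dv
      ... | just a  = a , refl , ≤-trans (bounded′ Dv) (s≤s z≤n)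
      ... | nothing = ⊥-elim (saturated st Dv (lose (∈-allFin i) (v∉S , indep)))
      layered′ : ∀ {v} → lookup D v ≡ just 1 → 1 + unlabelled D ≤ n
      layered′ {v} Dv = begin
        1 + unlabelled D                ≤⟨ +-monoˡ-≤ _ (countᵇ-pos (labelIs 1) D v (cong (labelIs 1) Dv)) ⟩
        labelled 1 D + unlabelled D     ≡⟨ conserved st ⟩
        labelled 1 D₀ + unlabelled D₀   ≡⟨ cong₂ _+_ (labelled-replicate n 1) (unlabelled-replicate n) ⟩
        n                               ∎
        where open ≤-Reasoning

    next-layer : ∀ {d D D′ tasks q} → 1 ≤ d → BFSUpTo d D →
                 Step (suc d) (AugmentsSome exchangeTask (findIndicesᵇ (labelIs d) D)) tasks D D′ q →
                 BFSUpTo (suc d) D′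
    next-layer {d} {D} {D′} 1≤d inv st =
      record { sound = sound′ ; complete = complete′ ; bounded = bounded′ ; layered = layered′ }
      where
      Frontier = AugmentsSome exchangeTask (findIndicesᵇ (labelIs d) D)

      no-edge-to-T : ∀ {v} → lookup D v ≡ nothing → ∀ i → ¬ Augments (M i) (S[ part ] i) v
      no-edge-to-T Dv i (v∉S , indep) with complete inv (step (toT i _ v∉S indep) (here i)) 1≤d
      ... | _ , Dv′ , _ with () ← trans (sym Dv) Dv′

      frontier-source : ∀ {v} → Frontier v → ∃ λ u → lookup D u ≡ just d × Augmentsᵗ (exchangeTask u) v
      frontier-source g with find g
      ... | u , u∈ , augments = u , labelIs⇒≡ (lookup D u) (∈-findIndicesᵇ⁻ (labelIs d) D u∈) , augments

      reach⇒frontier : ∀ {v} → lookup D v ≡ nothing → Reach (elem v) (suc d) → Frontier v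
      reach⇒frontier Dv (step (toT i _ v∉S indep) _) = ⊥-elim (no-edge-to-T Dv i (v∉S , indep))
      reach⇒frontier Dv (step e@(exch _ _ u _ _ _) r) with complete inv r ≤-refl
      ... | b , Du , b≤d with m≤n⇒m<n∨m≡n b≤d
      ...   | inj₂ refl = lose (∈-findIndicesᵇ⁺ (labelIs d) D (trans (cong (labelIs d) Du) (labelIs-refl d)))
                               (edge⇒augmentsᵗ e)
      ...   | inj₁ b<d with complete inv (step e (sound inv Du)) b<d
      ...     | _ , Dv′ , _ with () ← trans (sym Dv) Dv′

      sound′ : ∀ {v a} → lookup D′ v ≡ just a → Reach (elem v) a
      sound′ D′v with new-labels st D′v
      ... | inj₁ Dv              = sound inv Dv
      ... | inj₂ (Dv , refl , g) with frontier-source g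
      ...   | u , Du , augments =
        step (augmentsᵗ⇒edge (labelled≢unlabelled D Du Dv) (no-edge-to-T Dv) augments) (sound inv Du)

      bounded′ : ∀ {v a} → lookup D′ v ≡ just a → a ≤ suc d
      bounded′ D′v with new-labels st D′v
      ... | inj₁ Dv           = m≤n⇒m≤1+n (bounded inv Dv)
      ... | inj₂ (_ , refl , _) = ≤-refl

      complete′ : ∀ {v ℓ} → Reach (elem v) ℓ → ℓ ≤ suc d → ∃ λ a → lookup D′ v ≡ just a × a ≤ ℓ
      complete′ {v} {ℓ} r ℓ≤1+d with ℓ ≤? d | lookup D v in Dv
      ... | yes ℓ≤d | _ with complete inv r ℓ≤d
      ...   | a , Dv′ , a≤ℓ = a , preserves st Dv′ , a≤ℓ
      complete′ r ℓ≤1+d | no ℓ≰d | just a  = a , preserves st Dv , ≤-trans (bounded inv Dv) (<⇒≤ (≰⇒> ℓ≰d))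
      complete′ r ℓ≤1+d | no ℓ≰d | nothing rewrite ≤-antisym ℓ≤1+d (≰⇒> ℓ≰d) =
        suc d , step-labels st Dv (reach⇒frontier Dv r) , ≤-refl

      layered′ : ∀ {v} → lookup D′ v ≡ just (suc d) → suc d + unlabelled D′ ≤ n
      layered′ {v} D′v with new-labels st D′v
      ... | inj₁ Dv = ⊥-elim (1+n≰n (bounded inv Dv))
      ... | inj₂ (_ , _ , g) with frontier-source g
      ...   | u , Du , _ = begin
        suc d + unlabelled D′               ≡⟨ +-suc d (unlabelled D′) ⟨
        d + suc (unlabelled D′)             ≤⟨ +-monoʳ-≤ d (+-monoˡ-≤ _ (countᵇ-pos (labelIs (suc d)) D′ v
                                                                   (trans (cong (labelIs (suc d)) D′v) (labelIs-refl (suc d))))) ⟩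
        d + (labelled (suc d) D′ + unlabelled D′) ≡⟨ cong (d +_) (conserved st) ⟩
        d + (labelled (suc d) D + unlabelled D)   ≡⟨ cong (λ l → d + (l + unlabelled D)) (nothing-beyond inv) ⟩
        d + unlabelled D                    ≤⟨ layered inv Du ⟩
        n                                   ∎
        where open ≤-Reasoning

    Finished : Labels n → Set
    Finished D = ∃ λ d → 1 ≤ d × BFSUpTo d D × (∀ {v} → lookup D v ≢ just d)

    -- Each unlabelled element holds costPerLabel queries for its discovery and one for its own task
    -- in the next round; each element of the frontier still holds the query for its task.
    rounds-finish : ∀ f d D q₀ → 1 ≤ d → BFSUpTo d D → n < d + f →
                    q₀ + suc (costPerLabel n) * unlabelled D + labelled d D ≤ budget n k →
                    rounds f d D satisfies λ D′ q → Finished D′ × q₀ + q ≤ budget n k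
    rounds-finish zero d D q₀ 1≤d inv n<d+0 within =
      (d , 1≤d , inv , λ Dv → 1+n≰n (≤-trans n<d+0 (≤-trans (≤-reflexive (+-identityʳ d))
                                       (≤-trans (m≤m+n d _) (layered inv Dv))))) ,
      ≤-trans (≤-reflexive (+-identityʳ q₀)) (≤-trans (≤-trans (m≤m+n q₀ _) (m≤m+n _ _)) within)
    rounds-finish (suc f) d D q₀ 1≤d inv n<d+1+f within =
      >>=-satisfies (saturateAll exchangeTask F (suc d) D) {Q = λ D′ q → Finished D′ × q₀ + q ≤ budget n k}
        (saturateAll-saturates exchangeTask exchangeTask-valid F (suc d) D) continue
      where
      F = findIndicesᵇ (labelIs d) D
      within′ : ∀ {D′ q} → Step (suc d) (AugmentsSome exchangeTask F) (length F) D D′ q →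
                q₀ + q + suc (costPerLabel n) * unlabelled D′ + labelled (suc d) D′ ≤ budget n k
      within′ {D′} {q} st =
        ≤-trans (potential-nonincreasing {q₀} {q} {costPerLabel n} {labelled d D} {unlabelled D} {unlabelled D′}
                   paid relabelled)
                within
        where
        paid = ≤-trans (cost st) (≤-reflexive (cong (_+ _) (length-findIndicesᵇ (labelIs d) D)))
        relabelled = trans (conserved st) (cong (_+ unlabelled D) (nothing-beyond inv))
      continue : ∀ D′ q → Step (suc d) (AugmentsSome exchangeTask F) (length F) D D′ q →
                 rounds f (suc d) D′ satisfies λ D″ q′ → Finished D″ × q₀ + (q + q′) ≤ budget n k
      continue D′ q st =
        Data.Product.map₂ (≤-trans (≤-reflexive (sym (+-assoc q₀ q _))))
          (rounds-finish f (suc d) D′ (q₀ + q) (m≤n⇒m≤1+n 1≤d) (next-layer 1≤d inv st)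
            (subst (n <_) (+-suc d f) n<d+1+f) (within′ st))

    module _ {d D} (1≤d : 1 ≤ d) (inv : BFSUpTo d D) (top : ∀ {v} → lookup D v ≢ just d) where

      labels-are-distances : ∀ {v ℓ} → Reach (elem v) ℓ → ∃ λ a → lookup D v ≡ just a × a ≤ ℓ
      labels-are-distances {v} {ℓ} r with ℓ ≤? d
      ... | yes ℓ≤d = complete inv r ℓ≤d
      labels-are-distances (step (toT _ _ _ _) r) | no ℓ≰d rewrite ReachT-tgt r = ⊥-elim (ℓ≰d 1≤d)
      labels-are-distances (step e@(exch _ _ _ _ _ _) r) | no ℓ≰d with labels-are-distances r
      ... | b , Du , b≤ℓ
        with complete inv (step e (sound inv Du)) (≤∧≢⇒< (bounded inv Du) (top ∘ trans Du ∘ cong just))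
      ...   | a , Dv , a≤1+b = a , Dv , ≤-trans a≤1+b (s≤s b≤ℓ)

      source-labels : List (Maybe ℕ)
      source-labels = map (sourceLabel D) (allFin n)

      sourceLabel-just : ∀ v {a} → sourceLabel D v ≡ just a → v ∉ Sall part × lookup D v ≡ just a
      sourceLabel-just v eq with v ∈? Sall part
      ... | no v∉S = v∉S , eq

      sourceLabel-∉ : ∀ {v} → v ∉ Sall part → sourceLabel D v ≡ lookup D v
      sourceLabel-∉ {v} v∉S with v ∈? Sall part
      ... | yes v∈S = ⊥-elim (v∉S v∈S)
      ... | no _    = refl

      reach-src⇒minJust≤ : ∀ {ℓ} → Reach src ℓ → ∃ λ b → minJust source-labels ≡ just b × suc b ≤ ℓ
      reach-src⇒minJust≤ (step (fromS v v∉S) r) with labels-are-distances r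
      ... | a , Dv , a≤ℓ with ∈⇒minJust≤ (subst (_∈ˡ source-labels) (trans (sourceLabel-∉ v∉S) Dv)
                                                 (∈-map⁺ (sourceLabel D) (∈-allFin v)))
      ...   | b , min≡b , b≤a = b , min≡b , s≤s (≤-trans b≤a a≤ℓ)

      distances-correct : ∀ x → IsDistToT M part x (distances D x)
      distances-correct (elem v) with lookup D v in Dv
      ... | just a  = sound inv Dv , λ ℓ r → let a′ , Dv′ , a′≤ℓ = labels-are-distances r in
                                           subst (_≤ ℓ) (just-injective (trans (sym Dv′) Dv)) a′≤ℓ
      ... | nothing = λ ℓ r → let _ , Dv′ , _ = labels-are-distances r in
                              nothing≢just (trans (sym Dv) Dv′)
      distances-correct (tgt i) = here i , λ _ _ → z≤n
      distances-correct src with minJust source-labels in min≡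
      ... | just a with ∈-map⁻ (sourceLabel D) (minJust-∈ source-labels min≡)
      ...   | v , _ , a≡ with sourceLabel-just v (sym a≡)
      ...     | v∉S , Dv = step (fromS v v∉S) (sound inv Dv) , minimal
        where
        minimal : ∀ ℓ → Reach src ℓ → suc a ≤ ℓ
        minimal ℓ r with reach-src⇒minJust≤ r
        ... | b , min≡b , 1+b≤ℓ = subst (λ c → suc c ≤ ℓ) (just-injective (trans (sym min≡b) min≡)) 1+b≤ℓ
      distances-correct src | nothing =
        λ ℓ r → nothing≢just (trans (sym min≡) (proj₁ (proj₂ (reach-src⇒minJust≤ r))))

    bfs-correct : bfs satisfies λ out q → q ≤ budget n k × ∀ x → IsDistToT M part x (out x)
    bfs-correct =
      >>=-satisfies (saturateAll targetTask (allFin k) 1 D₀) {Q = Correct}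
        (saturateAll-saturates targetTask S-indep (allFin k) 1 D₀) after-first-layer
      where
      D₀ = replicate n nothing
      c = costPerLabel n

      Correct : (Vtx n k → Maybe ℕ) → ℕ → Set
      Correct out q = q ≤ budget n k × ∀ x → IsDistToT M part x (out x)

      first-within : ∀ {D q} → Step 1 (AugmentsSome targetTask (allFin k)) (length (allFin k)) D₀ D q →
                     q + suc c * unlabelled D + labelled 1 D ≤ budget n k
      first-within {D} {q} st = begin
        q + suc c * unlabelled D + labelled 1 D
          ≤⟨ potential-nonincreasing {0} {q} {c} {k} {n} {unlabelled D} paid conserved′ ⟩
        suc c * n + k
          ≡⟨ +-comm (suc c * n) k ⟩
        budget n k
          ∎
        where
        open ≤-Reasoning
        paid : q + c * unlabelled D ≤ k + c * n
        paid = ≤-trans (cost st)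
                 (≤-reflexive (cong₂ (λ t u → t + c * u) (length-tabulate {n = k} id) (unlabelled-replicate n)))
        conserved′ : labelled 1 D + unlabelled D ≡ n
        conserved′ = trans (conserved st) (cong₂ _+_ (labelled-replicate n 1) (unlabelled-replicate n))

      after-first-layer : ∀ D q → Step 1 (AugmentsSome targetTask (allFin k)) (length (allFin k)) D₀ D q →
                          (rounds n 1 D >>= λ D′ → ret (distances D′)) satisfies λ out q′ → Correct out (q + q′)
      after-first-layer D q st =
        >>=-satisfies (rounds n 1 D) {Q = λ out q′ → Correct out (q + q′)}
          (rounds-finish n 1 D q ≤-refl (first-layer st) (n<1+n n) (first-within st)) finish
        where
        finish : ∀ D′ q′ → Finished D′ × q + q′ ≤ budget n k →
                 ret (distances D′) satisfies λ out q″ → Correct out (q + (q′ + q″))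
        finish D′ q′ ((d , 1≤d , inv , top) , within) =
          subst (_≤ budget n k) (cong (q +_) (sym (+-identityʳ q′))) within , distances-correct 1≤d inv top

budget≤bound : ∀ n k → budget n k ≤ bound 3 n k
budget≤bound n k = ≤-trans (m≤m+n _ _) (≤-reflexive (sym (expand n k ⌊log₂ n ⌋)))
  where
  expand : ∀ n k L → 3 * (n + k) * suc L ≡ (k + suc (suc (suc L)) * n) + (2 * k + 2 * n * L + 3 * k * L)
  expand = solve-∀

lemma13 : Σ ((n k : ℕ) → Part n k → OracleAlg n k (Vtx n k → Maybe ℕ)) λ alg →
    ∃ λ (c : ℕ) →
      ∀ (n k : ℕ) (M : Fin k → Matroid n) (part : Part n k) →
      (∀ i → Indep (M i) (S[ part ] i)) →
      (rk : Fin k → Subset n → ℕ) → (∀ i X → IsRank (M i) X (rk i X)) →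
      proj₂ (run rk (alg n k part)) ≤ bound c n k ×
      (∀ v → IsDistToT M part v (proj₁ (run rk (alg n k part)) v))
lemma13 = (λ n k part → Algorithm.bfs part) , 3 , λ n k M part S-indep rk rk-isRank →
  Data.Product.map₁ (λ within → ≤-trans within (budget≤bound n k))
    (Correctness.bfs-correct M rk rk-isRank part S-indep)
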